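{- Let $P$ be a partial latin square of order $n$. For each $\sigma\in\{1,\dots,n\}$ let $\nu(\sigma)$ be the number of times $\sigma$ appears in $P$, and for each empty cell $b$ of $P$ let $S(b)$ be the set of symbols supported by $b$. Suppose that \[\sum_{\sigma\in S(b)}\frac{1}{n-\nu(\sigma)}\ge 1\quad\text{for each empty cell } b \text{ of } P.\] Then $P$ satisfies Hall's Condition.
   Context: A partial latin square of order $n$ is an $n\times n$ array in which some cells are filled with symbols from $\{1,\dots,n\}$, no symbol appearing twice in any row or column. A symbol is missing from a row (column) if it does not appear in a filled cell of that row (column). A cell supports $\sigma$ if it contains $\sigma$, or it is empty and $\sigma$ is missing from both its row and its column. A set of cells is independent if no two lie in the same row or column; an independent set for $\sigma$ is an independent set all of whose cells support $\sigma$. For a set $T$ of cells, $\alpha(\sigma,T)$ is the maximum size of a subset of $T$ that is an independent set for $\sigma$. $P$ satisfies Hall's Condition if $\sum_{\sigma=1}^n\alpha(\sigma,T)\ge|T|$ for every set $T$ of cells of $P$. -}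

module Defs where

open import Data.Nat as ℕ using (ℕ; zero; suc; _∸_; _≤_)
open import Data.Fin using (Fin)
open import Data.Fin.Properties as FinP using (all?)
open import Data.Maybe using (Maybe; just; nothing)
open import Data.Maybe.Properties using (≡-dec)
open import Data.Product using (_×_; _,_; proj₁; proj₂)
open import Data.Product.Properties using () renaming (≡-dec to ×-≡-dec)
open import Data.List using (List; []; _∷_; length; filter; map; cartesianProduct; allFin; foldr)
open import Data.List.Relation.Unary.All using (All)
open import Data.List.Relation.Unary.All as All using (all?)
open import Data.List.Relation.Unary.AllPairs using (AllPairs; allPairs?)
open import Data.Rational as ℚ using (ℚ; 0ℚ; _/_)
open import Relation.Binary.PropositionalEquality using (_≡_; _≢_)
open import Relation.Nullary using (Dec; yes; no; ¬_)
open import Relation.Nullary.Decidable using (_×-dec_; ¬?)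

-- Symbols {1,…,n} are represented by Fin n (i.e. 0,…,n-1); rows and columns by Fin n.
Cell : ℕ → Set
Cell n = Fin n × Fin n

record PLS (n : ℕ) : Set where
  field
    entry    : Cell n → Maybe (Fin n)
    rowLatin : ∀ r c c′ σ → entry (r , c) ≡ just σ → entry (r , c′) ≡ just σ → c ≡ c′
    colLatin : ∀ r r′ c σ → entry (r , c) ≡ just σ → entry (r′ , c) ≡ just σ → r ≡ r′
open PLS public

module _ {n : ℕ} (P : PLS n) where

  Empty : Cell n → Set
  Empty b = entry P b ≡ nothing

  MissingRow : Fin n → Fin n → Set
  MissingRow σ r = ∀ c → entry P (r , c) ≢ just σ

  MissingCol : Fin n → Fin n → Set
  MissingCol σ c = ∀ r → entry P (r , c) ≢ just σ

  data Supports (σ : Fin n) : Cell n → Set where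
    contains  : ∀ {b} → entry P b ≡ just σ → Supports σ b
    emptyMiss : ∀ {r c} → entry P (r , c) ≡ nothing → MissingRow σ r → MissingCol σ c
              → Supports σ (r , c)

  supports? : ∀ σ b → Dec (Supports σ b)
  supports? σ (r , c) with ≡-dec FinP._≟_ (entry P (r , c)) (just σ)
  ... | yes e = yes (contains e)
  ... | no ne with ≡-dec FinP._≟_ (entry P (r , c)) nothing
            | FinP.all? (λ c′ → ¬? (≡-dec FinP._≟_ (entry P (r , c′)) (just σ)))
            | FinP.all? (λ r′ → ¬? (≡-dec FinP._≟_ (entry P (r′ , c)) (just σ)))
  ... | yes e | yes mr | yes mc = yes (emptyMiss e mr mc)
  ... | no ¬e | _ | _ = no λ { (contains x) → ne x ; (emptyMiss x _ _) → ¬e x }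
  ... | yes _ | no ¬mr | _ = no λ { (contains x) → ne x ; (emptyMiss _ mr _) → ¬mr mr }
  ... | yes _ | yes _ | no ¬mc = no λ { (contains x) → ne x ; (emptyMiss _ _ mc) → ¬mc mc }

Independent : ∀ {n} → List (Cell n) → Set
Independent = AllPairs (λ a b → proj₁ a ≢ proj₁ b × proj₂ a ≢ proj₂ b)

independent? : ∀ {n} (I : List (Cell n)) → Dec (Independent I)
independent? = allPairs? (λ a b → ¬? (proj₁ a FinP.≟ proj₁ b) ×-dec ¬? (proj₂ a FinP.≟ proj₂ b))

IndependentFor : ∀ {n} → PLS n → Fin n → List (Cell n) → Set
IndependentFor P σ I = Independent I × All (Supports P σ) I

independentFor? : ∀ {n} (P : PLS n) σ (I : List (Cell n)) → Dec (IndependentFor P σ I)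
independentFor? P σ I = independent? I ×-dec All.all? (supports? P σ) I

subsets : ∀ {A : Set} → List A → List (List A)
subsets []       = [] ∷ []
subsets (x ∷ xs) = let s = subsets xs in s Data.List.++ map (x ∷_) s

maxℕ : List ℕ → ℕ
maxℕ = foldr ℕ._⊔_ 0

α : ∀ {n} → PLS n → Fin n → List (Cell n) → ℕ
α P σ T = maxℕ (map length (filter (independentFor? P σ) (subsets T)))

import Data.Nat.ListAction
sumℕ : ∀ {n} → (Fin n → ℕ) → ℕ
sumℕ {n} f = Data.Nat.ListAction.sum (map f (allFin n))

allCells : ∀ n → List (Cell n)
allCells n = cartesianProduct (allFin n) (allFin n)

-- A set of cells of P is a duplicate-free list of cells; |T| = length T.
open import Data.List.Relation.Unary.Unique.Propositional using (Unique)

HallsCondition : ∀ {n} → PLS n → Set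
HallsCondition {n} P = ∀ (T : List (Cell n)) → Unique T → length T ≤ sumℕ (λ σ → α P σ T)

ν : ∀ {n} → PLS n → Fin n → ℕ
ν {n} P σ = length (filter (λ b → ≡-dec FinP._≟_ (entry P b) (just σ)) (allCells n))

-- 1/k as a rational (k > 0 in every use below; 1/0 is set to 0 by convention)
inv : ℕ → ℚ
inv zero    = 0ℚ
inv (suc k) = Data.Integer.+_ 1 / suc k
  where import Data.Integer

weight : ∀ {n} → PLS n → Cell n → ℚ
weight {n} P b = foldr ℚ._+_ 0ℚ (map (λ σ → inv (n ∸ ν P σ)) (filter (λ σ → supports? P σ b) (allFin n)))

-- Fix a symbol σ and let k = n − ν(σ). Since σ occupies ν(σ) rows and columns, at most k rows and at
-- most k columns miss σ, so the empty cells supporting σ sit inside a k × k grid, which splits into k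
-- broken diagonals. Each diagonal, together with the cells containing σ, is an independent set for σ.
-- Give a cell weight 1 for σ if it contains σ and 1/k if it is empty and supports σ: then the weight of
-- any T is the average of |T ∩ diagonal| over the k diagonals, hence at most α(σ,T). Every cell carries
-- total weight at least 1 over all symbols (its own symbol, or the hypothesis if it is empty), so
-- |T| ≤ Σ_σ α(σ,T).

module Submission where

open import Defs
open import Data.Nat using (ℕ)
open import Data.Rational using (1ℚ; _≤_)

open import Algebra.Bundles using (CommutativeMonoid)
import Algebra.Properties.CommutativeSemigroup as CommSemigroupProperties
open import Data.Empty using (⊥-elim)
open import Data.Fin using (Fin; zero; suc; toℕ)
import Data.Fin.Properties as Fin
import Data.Integer as ℤ
import Data.Integer.Properties as ℤ
open import Data.List using (List; []; _∷_; _++_; length; lookup; filter; map; foldr; downFrom; allFin)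
import Data.List.Properties as List
open import Data.List.Membership.Propositional using (_∈_)
open import Data.List.Membership.Propositional.Properties
  using (∈-lookup; ∈-map⁺; ∈-map⁻; ∈-++⁺ˡ; ∈-++⁺ʳ; ∈-filter⁺; ∈-filter⁻; ∈-allFin)
open import Data.List.Relation.Binary.Disjoint.Propositional using (Disjoint)
open import Data.List.Relation.Unary.All as All using (All; []; _∷_)
import Data.List.Relation.Unary.All.Properties as All
open import Data.List.Relation.Unary.AllPairs using (AllPairs; []; _∷_)
import Data.List.Relation.Unary.AllPairs.Properties as AllPairs
open import Data.List.Relation.Unary.Any using (here; there)
open import Data.List.Relation.Unary.Unique.Propositional using (Unique)
import Data.List.Relation.Unary.Unique.Propositional.Properties as Unique
open import Data.Maybe using (just; nothing)
open import Data.Maybe.Properties using (≡-dec)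
import Data.Nat as ℕ
import Data.Nat.Coprimality as Coprimality
open import Data.Nat.DivMod using (m≡m%n+[m/n]*n; m%n<n)
import Data.Nat.ListAction as ℕ
import Data.Nat.Properties as ℕ
open import Data.Product using (_×_; _,_; proj₁; proj₂)
open import Data.Rational as ℚ using (ℚ; 0ℚ; mkℚ; _+_; _*_; Positive)
import Data.Rational.Properties as ℚ
open import Data.Sum using (_⊎_; inj₁; inj₂)
open import Function using (_∘_)
open import Relation.Binary.PropositionalEquality
open import Relation.Nullary using (Dec; yes; no; ¬_)
open import Relation.Nullary.Decidable using (¬?; _×-dec_; _⊎-dec_)

fromℕ : ℕ → ℚ
fromℕ m = ℤ.+ m ℚ./ 1

fromℕ≡mkℚ : ∀ m → fromℕ m ≡ mkℚ (ℤ.+ m) 0 (Coprimality.sym (Coprimality.1-coprimeTo m))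
fromℕ≡mkℚ m = ℚ.normalize-coprime (Coprimality.sym (Coprimality.1-coprimeTo m))

fromℕ-+ : ∀ a b → fromℕ (a ℕ.+ b) ≡ fromℕ a + fromℕ b
fromℕ-+ a b rewrite fromℕ≡mkℚ a | fromℕ≡mkℚ b | ℤ.*-identityʳ (ℤ.+ a) | ℤ.*-identityʳ (ℤ.+ b) = refl

fromℕ-mono-≤ : ∀ {a b} → a ℕ.≤ b → fromℕ a ≤ fromℕ b
fromℕ-mono-≤ {a} {b} a≤b rewrite fromℕ≡mkℚ a | fromℕ≡mkℚ b =
  ℚ.*≤* (subst₂ ℤ._≤_ (sym (ℤ.*-identityʳ (ℤ.+ a))) (sym (ℤ.*-identityʳ (ℤ.+ b))) (ℤ.+≤+ a≤b))

fromℕ-cancel-≤ : ∀ {a b} → fromℕ a ≤ fromℕ b → a ℕ.≤ b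
fromℕ-cancel-≤ {a} {b} le rewrite fromℕ≡mkℚ a | fromℕ≡mkℚ b with le
... | ℚ.*≤* p rewrite ℤ.*-identityʳ (ℤ.+ a) | ℤ.*-identityʳ (ℤ.+ b) = ℤ.drop‿+≤+ p

fromℕ-pos : ∀ m .{{_ : ℕ.NonZero m}} → Positive (fromℕ m)
fromℕ-pos (ℕ.suc m) = ℚ.normalize-pos (ℕ.suc m) 1

fromℕ*inv : ∀ m → fromℕ (ℕ.suc m) * inv (ℕ.suc m) ≡ 1ℚ
fromℕ*inv m = begin
  fromℕ (ℕ.suc m) * inv (ℕ.suc m)
    ≡⟨ cong₂ _*_ (fromℕ≡mkℚ (ℕ.suc m)) (ℚ.normalize-coprime (Coprimality.1-coprimeTo (ℕ.suc m))) ⟩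
  p * ℚ.1/ p
    ≡⟨ ℚ.*-inverseʳ p ⟩
  1ℚ ∎
  where
    open ≡-Reasoning
    p : ℚ
    p = mkℚ (ℤ.+ ℕ.suc m) 0 (Coprimality.sym (Coprimality.1-coprimeTo (ℕ.suc m)))

inv-nonNeg : ∀ m → 0ℚ ≤ inv m
inv-nonNeg ℕ.zero    = ℚ.≤-refl
inv-nonNeg (ℕ.suc m) = ℚ.nonNegative⁻¹ (inv (ℕ.suc m)) {{ℚ.normalize-nonNeg 1 (ℕ.suc m)}}

_when_ : {B : Set} → ℚ → Dec B → ℚ
q when yes _ = q
q when no _  = 0ℚ

when-yes : ∀ {B : Set} {q} → B → (b? : Dec B) → q when b? ≡ q
when-yes b (yes _) = refl
when-yes b (no ¬b) = ⊥-elim (¬b b)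

when-no : ∀ {B : Set} {q} → ¬ B → (b? : Dec B) → q when b? ≡ 0ℚ
when-no ¬b (yes b) = ⊥-elim (¬b b)
when-no ¬b (no _)  = refl

when-⇔ : ∀ {B C : Set} {q} → (B → C) → (C → B) → (b? : Dec B) (c? : Dec C) → q when b? ≡ q when c?
when-⇔ f g (yes b) c? = sym (when-yes (f b) c?)
when-⇔ f g (no ¬b) c? = sym (when-no (¬b ∘ g) c?)

module _ {A : Set} where

  sumℚ : (A → ℚ) → List A → ℚ
  sumℚ f xs = foldr _+_ 0ℚ (map f xs)

  sumℚ-cong : ∀ {f g} xs → (∀ x → f x ≡ g x) → sumℚ f xs ≡ sumℚ g xs
  sumℚ-cong []       f≗g = refl
  sumℚ-cong (x ∷ xs) f≗g = cong₂ _+_ (f≗g x) (sumℚ-cong xs f≗g)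

  sumℚ-zero : ∀ xs → sumℚ (λ _ → 0ℚ) xs ≡ 0ℚ
  sumℚ-zero []       = refl
  sumℚ-zero (x ∷ xs) = trans (ℚ.+-identityˡ _) (sumℚ-zero xs)

  sumℚ-distrib-+ : ∀ f g xs → sumℚ (λ x → f x + g x) xs ≡ sumℚ f xs + sumℚ g xs
  sumℚ-distrib-+ f g []       = refl
  sumℚ-distrib-+ f g (x ∷ xs) =
    trans (cong (f x + g x +_) (sumℚ-distrib-+ f g xs)) (interchange (f x) (g x) _ _)
    where open CommSemigroupProperties (CommutativeMonoid.commutativeSemigroup ℚ.+-0-commutativeMonoid)

  *-distribˡ-sumℚ : ∀ c f xs → c * sumℚ f xs ≡ sumℚ (λ x → c * f x) xs
  *-distribˡ-sumℚ c f []       = ℚ.*-zeroʳ c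
  *-distribˡ-sumℚ c f (x ∷ xs) = trans (ℚ.*-distribˡ-+ c (f x) _) (cong (c * f x +_) (*-distribˡ-sumℚ c f xs))

  sumℚ-mono-≤ : ∀ {f g} xs → (∀ x → f x ≤ g x) → sumℚ f xs ≤ sumℚ g xs
  sumℚ-mono-≤ []       f≤g = ℚ.≤-refl
  sumℚ-mono-≤ (x ∷ xs) f≤g = ℚ.+-mono-≤ (f≤g x) (sumℚ-mono-≤ xs f≤g)

  sumℚ-nonNeg : ∀ {f} xs → (∀ x → 0ℚ ≤ f x) → 0ℚ ≤ sumℚ f xs
  sumℚ-nonNeg {f} xs 0≤f = subst (_≤ sumℚ f xs) (sumℚ-zero xs) (sumℚ-mono-≤ xs 0≤f)

  ∈⇒≤sumℚ : ∀ {f y} xs → (∀ x → 0ℚ ≤ f x) → y ∈ xs → f y ≤ sumℚ f xs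
  ∈⇒≤sumℚ {f} (x ∷ xs) 0≤f (here refl) =
    subst (_≤ sumℚ f (x ∷ xs)) (ℚ.+-identityʳ (f x)) (ℚ.+-monoʳ-≤ (f x) (sumℚ-nonNeg xs 0≤f))
  ∈⇒≤sumℚ {f} {y} (x ∷ xs) 0≤f (there y∈xs) =
    subst (_≤ sumℚ f (x ∷ xs)) (ℚ.+-identityˡ (f y)) (ℚ.+-mono-≤ (0≤f x) (∈⇒≤sumℚ xs 0≤f y∈xs))

  sumℚ-const : ∀ c xs → sumℚ (λ _ → c) xs ≡ fromℕ (length xs) * c
  sumℚ-const c []       = sym (ℚ.*-zeroˡ c)
  sumℚ-const c (x ∷ xs) = begin
    c + sumℚ (λ _ → c) xs              ≡⟨ cong₂ _+_ (sym (ℚ.*-identityˡ c)) (sumℚ-const c xs) ⟩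
    1ℚ * c + fromℕ (length xs) * c     ≡⟨ ℚ.*-distribʳ-+ c 1ℚ (fromℕ (length xs)) ⟨
    (1ℚ + fromℕ (length xs)) * c       ≡⟨ cong (_* c) (fromℕ-+ 1 (length xs)) ⟨
    fromℕ (length (x ∷ xs)) * c        ∎
    where open ≡-Reasoning

  sumℚ-1 : ∀ xs → sumℚ (λ _ → 1ℚ) xs ≡ fromℕ (length xs)
  sumℚ-1 xs = trans (sumℚ-const 1ℚ xs) (ℚ.*-identityʳ _)

  fromℕ-sum : ∀ (f : A → ℕ) xs → fromℕ (ℕ.sum (map f xs)) ≡ sumℚ (λ x → fromℕ (f x)) xs
  fromℕ-sum f []       = refl
  fromℕ-sum f (x ∷ xs) = trans (fromℕ-+ (f x) _) (cong (fromℕ (f x) +_) (fromℕ-sum f xs))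

  module _ {P : A → Set} (P? : ∀ x → Dec (P x)) where

    sumℚ-filter : ∀ f xs → sumℚ f (filter P? xs) ≡ sumℚ (λ x → f x when P? x) xs
    sumℚ-filter f []       = refl
    sumℚ-filter f (x ∷ xs) with P? x
    ... | yes _ = cong (f x +_) (sumℚ-filter f xs)
    ... | no _  = trans (sumℚ-filter f xs) (sym (ℚ.+-identityˡ _))

    fromℕ-length-filter : ∀ xs → fromℕ (length (filter P? xs)) ≡ sumℚ (λ x → 1ℚ when P? x) xs
    fromℕ-length-filter xs = trans (sym (sumℚ-1 (filter P? xs))) (sumℚ-filter (λ _ → 1ℚ) xs)

sumℚ-swap : ∀ {A B : Set} (f : A → B → ℚ) xs ys →
            sumℚ (λ x → sumℚ (f x) ys) xs ≡ sumℚ (λ y → sumℚ (λ x → f x y) xs) ys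
sumℚ-swap f []       ys = sym (sumℚ-zero ys)
sumℚ-swap f (x ∷ xs) ys =
  trans (cong (sumℚ (f x) ys +_) (sumℚ-swap f xs ys)) (sym (sumℚ-distrib-+ (f x) _ ys))

module _ where
  open import Data.Nat using (_<_; _%_; _/_; _∸_; NonZero)
  open import Data.Nat.Divisibility using (_∣_; divides; >⇒∤)

  %≡⇒∣∸ : ∀ u v m .{{_ : NonZero m}} → u % m ≡ v % m → m ∣ v ∸ u
  %≡⇒∣∸ u v m eq = divides (v / m ∸ u / m) (begin
    v ∸ u
      ≡⟨ cong₂ _∸_ (m≡m%n+[m/n]*n v m) (m≡m%n+[m/n]*n u m) ⟩
    (v % m ℕ.+ v / m ℕ.* m) ∸ (u % m ℕ.+ u / m ℕ.* m)
      ≡⟨ cong (λ s → (v % m ℕ.+ v / m ℕ.* m) ∸ (s ℕ.+ u / m ℕ.* m)) eq ⟩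
    (v % m ℕ.+ v / m ℕ.* m) ∸ (v % m ℕ.+ u / m ℕ.* m)
      ≡⟨ ℕ.[m+n]∸[m+o]≡n∸o (v % m) _ _ ⟩
    v / m ℕ.* m ∸ u / m ℕ.* m
      ≡⟨ ℕ.*-distribʳ-∸ m (v / m) (u / m) ⟨
    (v / m ∸ u / m) ℕ.* m ∎)
    where open ≡-Reasoning

  ∣∧<⇒≡0 : ∀ {m d} → m ∣ d → d < m → d ≡ 0
  ∣∧<⇒≡0 {d = ℕ.zero}  _   _   = refl
  ∣∧<⇒≡0 {d = ℕ.suc _} m∣d d<m = ⊥-elim (>⇒∤ d<m m∣d)

  +-%-cancelˡ : ∀ a {x y} m .{{_ : NonZero m}} → x < m → y < m → (a ℕ.+ x) % m ≡ (a ℕ.+ y) % m → x ≡ y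
  +-%-cancelˡ a {x} {y} m x<m y<m eq = ℕ.≤-antisym (≤-via-∣∸ x<m (sym eq)) (≤-via-∣∸ y<m eq)
    where
      ≤-via-∣∸ : ∀ {u v} → u < m → (a ℕ.+ v) % m ≡ (a ℕ.+ u) % m → u ℕ.≤ v
      ≤-via-∣∸ {u} {v} u<m e = ℕ.m∸n≡0⇒m≤n (∣∧<⇒≡0
        (subst (m ∣_) (ℕ.[m+n]∸[m+o]≡n∸o a u v) (%≡⇒∣∸ (a ℕ.+ v) (a ℕ.+ u) m e))
        (ℕ.≤-<-trans (ℕ.m∸n≤m u v) u<m))

module _ {A : Set} where

  lookup-injective : ∀ {xs : List A} → Unique xs → ∀ {i j} → lookup xs i ≡ lookup xs j → i ≡ j
  lookup-injective (x∉xs ∷ xs!) {zero}  {zero}  _  = refl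
  lookup-injective (x∉xs ∷ xs!) {zero}  {suc j} eq = ⊥-elim (All.lookup x∉xs (∈-lookup j) eq)
  lookup-injective (x∉xs ∷ xs!) {suc i} {zero}  eq = ⊥-elim (All.lookup x∉xs (∈-lookup i) (sym eq))
  lookup-injective (x∉xs ∷ xs!) {suc i} {suc j} eq = cong suc (lookup-injective xs! eq)

Unique⇒length≤ : ∀ {n} {xs : List (Fin n)} → Unique xs → length xs ℕ.≤ n
Unique⇒length≤ xs! = Fin.injective⇒≤ (lookup-injective xs!)

allPairs-restrict : ∀ {A : Set} {Q : A → Set} {S R : A → A → Set} {xs : List A} →
                    (∀ {a b} → Q a → Q b → S a b → R a b) → All Q xs → AllPairs S xs → AllPairs R xs
allPairs-restrict f []         []         = []
allPairs-restrict f (qx ∷ qxs) (sx ∷ sxs) =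
  All.zipWith (λ (qy , s) → f qx qy s) (qxs , sx) ∷ allPairs-restrict f qxs sxs

module _ {n : ℕ} where
  open import Data.List.Membership.DecPropositional (Fin._≟_ {n}) using (_∈?_)
  open import Data.List.Relation.Unary.Any using (index)
  import Data.List.Membership.Setoid.Properties as Membership

  position : Fin n → List (Fin n) → ℕ
  position x xs with x ∈? xs
  ... | yes x∈xs = toℕ (index x∈xs)
  ... | no _     = 0

  position< : ∀ {x xs} → x ∈ xs → position x xs ℕ.< length xs
  position< {x} {xs} x∈xs with x ∈? xs
  ... | yes x∈xs′ = Fin.toℕ<n (index x∈xs′)
  ... | no x∉xs   = ⊥-elim (x∉xs x∈xs)

  position-injective : ∀ {x y xs} → x ∈ xs → y ∈ xs → position x xs ≡ position y xs → x ≡ y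
  position-injective {x} {y} {xs} x∈xs y∈xs eq with x ∈? xs | y ∈? xs
  ... | yes x∈xs′ | yes y∈xs′ =
    Membership.index-injective (setoid (Fin n)) x∈xs′ y∈xs′ (Fin.toℕ-injective eq)
  ... | no x∉xs   | _         = ⊥-elim (x∉xs x∈xs)
  ... | _         | no y∉xs   = ⊥-elim (y∉xs y∈xs)

∈⇒≤maxℕ : ∀ {x xs} → x ∈ xs → x ℕ.≤ maxℕ xs
∈⇒≤maxℕ {xs = y ∷ ys} (here refl)  = ℕ.m≤m⊔n y (maxℕ ys)
∈⇒≤maxℕ {xs = y ∷ ys} (there x∈ys) = ℕ.≤-trans (∈⇒≤maxℕ x∈ys) (ℕ.m≤n⊔m y (maxℕ ys))

filter∈subsets : ∀ {A : Set} {P : A → Set} (P? : ∀ x → Dec (P x)) xs → filter P? xs ∈ subsets xs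
filter∈subsets P? []       = here refl
filter∈subsets P? (x ∷ xs) with P? x
... | yes _ = ∈-++⁺ʳ (subsets xs) (∈-map⁺ (x ∷_) (filter∈subsets P? xs))
... | no _  = ∈-++⁺ˡ (filter∈subsets P? xs)

sumℚ-indicator-≥ : ∀ x K → K ℕ.≤ x → sumℚ (λ d → 1ℚ when (x ℕ.≟ d)) (downFrom K) ≡ 0ℚ
sumℚ-indicator-≥ x ℕ.zero    _   = refl
sumℚ-indicator-≥ x (ℕ.suc K) K<x with x ℕ.≟ K
... | yes refl = ⊥-elim (ℕ.<-irrefl refl K<x)
... | no _     = trans (ℚ.+-identityˡ _) (sumℚ-indicator-≥ x K (ℕ.<⇒≤ K<x))

sumℚ-indicator-< : ∀ x K → x ℕ.< K → sumℚ (λ d → 1ℚ when (x ℕ.≟ d)) (downFrom K) ≡ 1ℚ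
sumℚ-indicator-< x (ℕ.suc K) x<1+K with x ℕ.≟ K
... | yes refl = trans (cong (1ℚ +_) (sumℚ-indicator-≥ x K ℕ.≤-refl)) (ℚ.+-identityʳ 1ℚ)
... | no x≢K   = trans (ℚ.+-identityˡ _) (sumℚ-indicator-< x K (ℕ.≤∧≢⇒< (ℕ.≤-pred x<1+K) x≢K))

module _ {A : Set} {Q : ℕ → A → Set} (Q? : ∀ d b → Dec (Q d b)) where

  fractional-cover : ∀ K .{{_ : ℕ.NonZero K}} (h : A → ℚ) T m →
                     (∀ b → fromℕ K * h b ≡ sumℚ (λ d → 1ℚ when Q? d b) (downFrom K)) →
                     (∀ d → length (filter (Q? d) T) ℕ.≤ m) →
                     sumℚ h T ≤ fromℕ m
  fractional-cover K h T m cover bound = ℚ.*-cancelˡ-≤-pos (fromℕ K) {{fromℕ-pos K}} (begin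
    fromℕ K * sumℚ h T
      ≡⟨ *-distribˡ-sumℚ (fromℕ K) h T ⟩
    sumℚ (λ b → fromℕ K * h b) T
      ≡⟨ sumℚ-cong T cover ⟩
    sumℚ (λ b → sumℚ (λ d → 1ℚ when Q? d b) (downFrom K)) T
      ≡⟨ sumℚ-swap (λ b d → 1ℚ when Q? d b) T (downFrom K) ⟩
    sumℚ (λ d → sumℚ (λ b → 1ℚ when Q? d b) T) (downFrom K)
      ≡⟨ sumℚ-cong (downFrom K) (λ d → fromℕ-length-filter (Q? d) T) ⟨
    sumℚ (λ d → fromℕ (length (filter (Q? d) T))) (downFrom K)
      ≤⟨ sumℚ-mono-≤ (downFrom K) (λ d → fromℕ-mono-≤ (bound d)) ⟩
    sumℚ (λ _ → fromℕ m) (downFrom K)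
      ≡⟨ sumℚ-const (fromℕ m) (downFrom K) ⟩
    fromℕ (length (downFrom K)) * fromℕ m
      ≡⟨ cong (λ k → fromℕ k * fromℕ m) (List.length-downFrom K) ⟩
    fromℕ K * fromℕ m ∎)
    where open ℚ.≤-Reasoning

Apart : ∀ {n} → Cell n → Cell n → Set
Apart a b = proj₁ a ≢ proj₁ b × proj₂ a ≢ proj₂ b

apart-sym : ∀ {n} {a b : Cell n} → Apart a b → Apart b a
apart-sym (rows , cols) = rows ∘ sym , cols ∘ sym

module Symbol {n : ℕ} (P : PLS n) (σ : Fin n) where

  σ-at? : ∀ b → Dec (entry P b ≡ just σ)
  σ-at? b = ≡-dec Fin._≟_ (entry P b) (just σ)

  missingRow? : ∀ r → Dec (MissingRow P σ r)
  missingRow? r = Fin.all? (λ c → ¬? (σ-at? (r , c)))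

  missingCol? : ∀ c → Dec (MissingCol P σ c)
  missingCol? c = Fin.all? (λ r → ¬? (σ-at? (r , c)))

  missingRows missingCols : List (Fin n)
  missingRows = filter missingRow? (allFin n)
  missingCols = filter missingCol? (allFin n)

  Free : Cell n → Set
  Free (r , c) = MissingRow P σ r × MissingCol P σ c

  k : ℕ
  k = n ℕ.∸ ν P σ

  σ-cells-apart : ∀ {a b} → entry P a ≡ just σ → entry P b ≡ just σ → a ≢ b → Apart a b
  σ-cells-apart {r , c} {r′ , c′} σ∈a σ∈b a≢b = rows , cols
    where
      rows : r ≢ r′
      rows refl = a≢b (cong (r ,_) (rowLatin P r c c′ σ σ∈a σ∈b))
      cols : c ≢ c′
      cols refl = a≢b (cong (_, c) (colLatin P r r′ c σ σ∈a σ∈b))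

  σ-cell-free-apart : ∀ {a b} → entry P a ≡ just σ → Free b → Apart a b
  σ-cell-free-apart {r , c} σ∈a (missingRow , missingCol) =
    (λ { refl → missingRow c σ∈a }) , (λ { refl → missingCol r σ∈a })

  free-lines-bound : (line : Cell n → Fin n) {L : Fin n → Set} (L? : ∀ i → Dec (L i)) →
                     (∀ {a b} → entry P a ≡ just σ → entry P b ≡ just σ → a ≢ b → line a ≢ line b) →
                     (∀ {b} → entry P b ≡ just σ → ¬ L (line b)) →
                     length (filter L? (allFin n)) ℕ.≤ k
  free-lines-bound line L? line-apart σ-not-free =
    ℕ.m+n≤o⇒m≤o∸n (length free) (subst (ℕ._≤ n) lines++free-length (Unique⇒length≤ lines++free!))
    where
      σ-cells free : List _
      σ-cells = filter σ-at? (allCells n)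
      free    = filter L? (allFin n)

      lines! : Unique (map line σ-cells)
      lines! = AllPairs.map⁺ (allPairs-restrict line-apart (All.all-filter σ-at? (allCells n))
        (Unique.filter⁺ σ-at? (Unique.cartesianProduct⁺ (Unique.allFin⁺ n) (Unique.allFin⁺ n))))

      disjoint : Disjoint (map line σ-cells) free
      disjoint (i∈lines , i∈free) with ∈-map⁻ line i∈lines
      ... | b , b∈σ-cells , refl = σ-not-free (proj₂ (∈-filter⁻ σ-at? {xs = allCells n} b∈σ-cells))
                                              (proj₂ (∈-filter⁻ L? {xs = allFin n} i∈free))

      lines++free! : Unique (map line σ-cells ++ free)
      lines++free! = Unique.++⁺ lines! (Unique.filter⁺ L? (Unique.allFin⁺ n)) disjoint

      lines++free-length : length (map line σ-cells ++ free) ≡ length free ℕ.+ ν P σ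
      lines++free-length = begin
        length (map line σ-cells ++ free)           ≡⟨ List.length-++ (map line σ-cells) ⟩
        length (map line σ-cells) ℕ.+ length free   ≡⟨ cong (ℕ._+ length free) (List.length-map line σ-cells) ⟩
        ν P σ ℕ.+ length free                       ≡⟨ ℕ.+-comm (ν P σ) (length free) ⟩
        length free ℕ.+ ν P σ                       ∎
        where open ≡-Reasoning

  missingRows-bound : length missingRows ℕ.≤ k
  missingRows-bound = free-lines-bound proj₁ missingRow?
    (λ σ∈a σ∈b a≢b → proj₁ (σ-cells-apart σ∈a σ∈b a≢b))
    (λ {b} σ∈b missingRow → missingRow (proj₂ b) σ∈b)

  missingCols-bound : length missingCols ℕ.≤ k
  missingCols-bound = free-lines-bound proj₂ missingCol?
    (λ σ∈a σ∈b a≢b → proj₂ (σ-cells-apart σ∈a σ∈b a≢b))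
    (λ {b} σ∈b missingCol → missingCol (proj₁ b) σ∈b)

  -- max k 1: a nonzero modulus, equal to k as soon as some empty cell supports σ.
  K : ℕ
  K = ℕ.suc (ℕ.pred k)

  k≤K : k ℕ.≤ K
  k≤K = ℕ.m≤n+m∸n k 1

  row∈missingRows : ∀ {r} → MissingRow P σ r → r ∈ missingRows
  row∈missingRows missingRow = ∈-filter⁺ missingRow? (∈-allFin _) missingRow

  col∈missingCols : ∀ {c} → MissingCol P σ c → c ∈ missingCols
  col∈missingCols missingCol = ∈-filter⁺ missingCol? (∈-allFin _) missingCol

  row-position< : ∀ {r} → MissingRow P σ r → position r missingRows ℕ.< K
  row-position< missingRow =
    ℕ.<-≤-trans (position< (row∈missingRows missingRow)) (ℕ.≤-trans missingRows-bound k≤K)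

  col-position< : ∀ {c} → MissingCol P σ c → position c missingCols ℕ.< K
  col-position< missingCol =
    ℕ.<-≤-trans (position< (col∈missingCols missingCol)) (ℕ.≤-trans missingCols-bound k≤K)

  missingRow⇒K≡k : ∀ {r} → MissingRow P σ r → K ≡ k
  missingRow⇒K≡k missingRow = ℕ.m+[n∸m]≡n
    (ℕ.<-≤-trans (ℕ.≤-<-trans ℕ.z≤n (position< (row∈missingRows missingRow))) missingRows-bound)

  diagonal : Cell n → ℕ
  diagonal (r , c) = (position r missingRows ℕ.+ position c missingCols) ℕ.% K

  diagonal<K : ∀ b → diagonal b ℕ.< K
  diagonal<K (r , c) = m%n<n (position r missingRows ℕ.+ position c missingCols) K

  free-apart : ∀ {a b} → Free a → Free b → diagonal a ≡ diagonal b → a ≢ b → Apart a b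
  free-apart {r , c} {r′ , c′} (missingRow , missingCol) (missingRow′ , missingCol′) same a≢b = rows , cols
    where
      rows : r ≢ r′
      rows refl = a≢b (cong (r ,_) (position-injective (col∈missingCols missingCol) (col∈missingCols missingCol′)
        (+-%-cancelˡ (position r missingRows) K (col-position< missingCol) (col-position< missingCol′) same)))
      cols : c ≢ c′
      cols refl = a≢b (cong (_, c) (position-injective (row∈missingRows missingRow) (row∈missingRows missingRow′)
        (+-%-cancelˡ (position c missingCols) K (row-position< missingRow) (row-position< missingRow′)
          (subst₂ (λ x y → x ℕ.% K ≡ y ℕ.% K)
            (ℕ.+-comm (position r missingRows) _) (ℕ.+-comm (position r′ missingRows) _) same))))

  OnDiagonal : ℕ → Cell n → Set
  OnDiagonal d b = entry P b ≡ just σ ⊎ Supports P σ b × diagonal b ≡ d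

  onDiagonal? : ∀ d b → Dec (OnDiagonal d b)
  onDiagonal? d b = σ-at? b ⊎-dec (supports? P σ b ×-dec (diagonal b ℕ.≟ d))

  onDiagonal-supports : ∀ {d b} → OnDiagonal d b → Supports P σ b
  onDiagonal-supports (inj₁ σ∈b)           = contains σ∈b
  onDiagonal-supports (inj₂ (supports , _)) = supports

  onDiagonal-view : ∀ {d b} → OnDiagonal d b → entry P b ≡ just σ ⊎ Free b × diagonal b ≡ d
  onDiagonal-view (inj₁ σ∈b)                                     = inj₁ σ∈b
  onDiagonal-view (inj₂ (contains σ∈b , _))                      = inj₁ σ∈b
  onDiagonal-view (inj₂ (emptyMiss _ missingRow missingCol , on)) = inj₂ ((missingRow , missingCol) , on)

  onDiagonal-apart : ∀ {d a b} → OnDiagonal d a → OnDiagonal d b → a ≢ b → Apart a b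
  onDiagonal-apart on-a on-b = apart (onDiagonal-view on-a) (onDiagonal-view on-b)
    where
      apart : ∀ {d a b} → entry P a ≡ just σ ⊎ Free a × diagonal a ≡ d →
              entry P b ≡ just σ ⊎ Free b × diagonal b ≡ d → a ≢ b → Apart a b
      apart (inj₁ σ∈a)          (inj₁ σ∈b)          a≢b = σ-cells-apart σ∈a σ∈b a≢b
      apart (inj₁ σ∈a)          (inj₂ (free-b , _)) _   = σ-cell-free-apart σ∈a free-b
      apart (inj₂ (free-a , _)) (inj₁ σ∈b)          _   = apart-sym (σ-cell-free-apart σ∈b free-a)
      apart (inj₂ (free-a , on-a)) (inj₂ (free-b , on-b)) a≢b = free-apart free-a free-b (trans on-a (sym on-b)) a≢b

  diagonal-independent : ∀ d {T} → Unique T → IndependentFor P σ (filter (onDiagonal? d) T)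
  diagonal-independent d {T} T! =
    allPairs-restrict onDiagonal-apart on-d (AllPairs.filter⁺ (onDiagonal? d) T!) , All.map onDiagonal-supports on-d
    where
      on-d : All (OnDiagonal d) (filter (onDiagonal? d) T)
      on-d = All.all-filter (onDiagonal? d) T

  diagonal≤α : ∀ d {T} → Unique T → length (filter (onDiagonal? d) T) ℕ.≤ α P σ T
  diagonal≤α d {T} T! = ∈⇒≤maxℕ (∈-map⁺ length
    (∈-filter⁺ (independentFor? P σ) (filter∈subsets (onDiagonal? d) T) (diagonal-independent d T!)))

  shareBy : ∀ {b} → Dec (Supports P σ b) → Dec (entry P b ≡ just σ) → ℚ
  shareBy (no _)  _       = 0ℚ
  shareBy (yes _) (yes _) = 1ℚ
  shareBy (yes _) (no _)  = inv k

  share : Cell n → ℚ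
  share b = shareBy (supports? P σ b) (σ-at? b)

  share-nonNeg : ∀ b → 0ℚ ≤ share b
  share-nonNeg b = nonNeg (supports? P σ b) (σ-at? b)
    where
      nonNeg : (s? : Dec (Supports P σ b)) (σ? : Dec (entry P b ≡ just σ)) → 0ℚ ≤ shareBy s? σ?
      nonNeg (no _)  _       = ℚ.≤-refl
      nonNeg (yes _) (yes _) = ℚ.nonNegative⁻¹ 1ℚ
      nonNeg (yes _) (no _)  = inv-nonNeg k

  share-σ-cell : ∀ {b} → entry P b ≡ just σ → share b ≡ 1ℚ
  share-σ-cell {b} σ∈b = at-σ-cell (supports? P σ b) (σ-at? b)
    where
      at-σ-cell : (s? : Dec (Supports P σ b)) (σ? : Dec (entry P b ≡ just σ)) → shareBy s? σ? ≡ 1ℚ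
      at-σ-cell (yes _)        (yes _)  = refl
      at-σ-cell (yes _)        (no σ∉b) = ⊥-elim (σ∉b σ∈b)
      at-σ-cell (no ¬supports) _        = ⊥-elim (¬supports (contains σ∈b))

  share-empty : ∀ {b} → Empty P b → share b ≡ inv k when supports? P σ b
  share-empty {b} b-empty = at-empty (supports? P σ b) (σ-at? b)
    where
      at-empty : (s? : Dec (Supports P σ b)) (σ? : Dec (entry P b ≡ just σ)) → shareBy s? σ? ≡ inv k when s?
      at-empty (yes _) (yes σ∈b) with () ← trans (sym b-empty) σ∈b
      at-empty (yes _) (no _)    = refl
      at-empty (no _)  _         = refl

  share-cover : ∀ b → fromℕ K * share b ≡ sumℚ (λ d → 1ℚ when onDiagonal? d b) (downFrom K)
  share-cover b = cover (supports? P σ b) (σ-at? b)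
    where
      open ≡-Reasoning
      cover : (s? : Dec (Supports P σ b)) (σ? : Dec (entry P b ≡ just σ)) →
              fromℕ K * shareBy s? σ? ≡ sumℚ (λ d → 1ℚ when onDiagonal? d b) (downFrom K)
      cover (no ¬supports) _ = begin
        fromℕ K * 0ℚ
          ≡⟨ ℚ.*-zeroʳ (fromℕ K) ⟩
        0ℚ
          ≡⟨ sumℚ-zero (downFrom K) ⟨
        sumℚ (λ _ → 0ℚ) (downFrom K)
          ≡⟨ sumℚ-cong (downFrom K) (λ d → when-no (¬supports ∘ onDiagonal-supports) (onDiagonal? d b)) ⟨
        sumℚ (λ d → 1ℚ when onDiagonal? d b) (downFrom K) ∎
      cover (yes _) (yes σ∈b) = begin
        fromℕ K * 1ℚ
          ≡⟨ ℚ.*-identityʳ (fromℕ K) ⟩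
        fromℕ K
          ≡⟨ cong fromℕ (List.length-downFrom K) ⟨
        fromℕ (length (downFrom K))
          ≡⟨ sumℚ-1 (downFrom K) ⟨
        sumℚ (λ _ → 1ℚ) (downFrom K)
          ≡⟨ sumℚ-cong (downFrom K) (λ d → when-yes (inj₁ σ∈b) (onDiagonal? d b)) ⟨
        sumℚ (λ d → 1ℚ when onDiagonal? d b) (downFrom K) ∎
      cover (yes (contains σ∈b)) (no σ∉b) = ⊥-elim (σ∉b σ∈b)
      cover (yes supports@(emptyMiss _ missingRow _)) (no σ∉b) = begin
        fromℕ K * inv k
          ≡⟨ cong (λ m → fromℕ K * inv m) (missingRow⇒K≡k missingRow) ⟨
        fromℕ K * inv K
          ≡⟨ fromℕ*inv (ℕ.pred k) ⟩
        1ℚ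
          ≡⟨ sumℚ-indicator-< (diagonal b) K (diagonal<K b) ⟨
        sumℚ (λ d → 1ℚ when (diagonal b ℕ.≟ d)) (downFrom K)
          ≡⟨ sumℚ-cong (downFrom K) (λ d →
               when-⇔ on⇒ (λ on → inj₂ (supports , on)) (onDiagonal? d b) (diagonal b ℕ.≟ d)) ⟨
        sumℚ (λ d → 1ℚ when onDiagonal? d b) (downFrom K) ∎
        where
          on⇒ : ∀ {d} → OnDiagonal d b → diagonal b ≡ d
          on⇒ (inj₁ σ∈b)      = ⊥-elim (σ∉b σ∈b)
          on⇒ (inj₂ (_ , on)) = on

  sumℚ-share≤α : ∀ {T} → Unique T → sumℚ share T ≤ fromℕ (α P σ T)
  sumℚ-share≤α {T} T! = fractional-cover onDiagonal? K share T (α P σ T) share-cover (λ d → diagonal≤α d T!)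

open Symbol using (share; share-nonNeg; share-σ-cell; share-empty; sumℚ-share≤α)

weight≡sumℚ-share : ∀ {n} (P : PLS n) {b} → Empty P b → weight P b ≡ sumℚ (λ σ → share P σ b) (allFin n)
weight≡sumℚ-share {n} P {b} b-empty =
  trans (sumℚ-filter (λ σ → supports? P σ b) (λ σ → inv (n ℕ.∸ ν P σ)) (allFin n))
        (sumℚ-cong (allFin n) (λ σ → sym (share-empty P σ b-empty)))

1≤sumℚ-share : ∀ {n} (P : PLS n) → (∀ b → Empty P b → 1ℚ ≤ weight P b) →
               ∀ b → 1ℚ ≤ sumℚ (λ σ → share P σ b) (allFin n)
1≤sumℚ-share {n} P empty⇒1≤weight b = by-entry (entry P b) refl
  where
    by-entry : ∀ e → entry P b ≡ e → 1ℚ ≤ sumℚ (λ σ → share P σ b) (allFin n)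
    by-entry (just τ) τ∈b = subst (_≤ sumℚ (λ σ → share P σ b) (allFin n)) (share-σ-cell P τ τ∈b)
                              (∈⇒≤sumℚ (allFin n) (λ σ → share-nonNeg P σ b) (∈-allFin τ))
    by-entry nothing b-empty = subst (1ℚ ≤_) (weight≡sumℚ-share P b-empty) (empty⇒1≤weight b b-empty)

theorem7 : ∀ (n : ℕ) (P : PLS n)
         → (∀ b → Empty P b → 1ℚ ≤ weight P b)
         → HallsCondition P
theorem7 n P empty⇒1≤weight T T! = fromℕ-cancel-≤ (begin
  fromℕ (length T)
    ≡⟨ sumℚ-1 T ⟨
  sumℚ (λ _ → 1ℚ) T
    ≤⟨ sumℚ-mono-≤ T (1≤sumℚ-share P empty⇒1≤weight) ⟩
  sumℚ (λ b → sumℚ (λ σ → share P σ b) (allFin n)) T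
    ≡⟨ sumℚ-swap (λ b σ → share P σ b) T (allFin n) ⟩
  sumℚ (λ σ → sumℚ (share P σ) T) (allFin n)
    ≤⟨ sumℚ-mono-≤ (allFin n) (λ σ → sumℚ-share≤α P σ T!) ⟩
  sumℚ (λ σ → fromℕ (α P σ T)) (allFin n)
    ≡⟨ fromℕ-sum (λ σ → α P σ T) (allFin n) ⟨
  fromℕ (sumℕ (λ σ → α P σ T)) ∎)
  where open ℚ.≤-Reasoning
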